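{- Let $n\ge3$, $k\ge0$. If $S$ is a maximal independent, non-reversible set in $G_n^k$ (i.e., $S$ is independent and non-reversible and is not properly contained in another independent set of $G_n^k$), then $S$ contains a strict alternating cycle of size $3$.
   Context: The crown $S_n^k$ is the height-2 poset on $A\cup B$, $A=\{a_1,\dots,a_{n+k}\}$ minimal, $B=\{b_1,\dots,b_{n+k}\}$ maximal, indices cyclic mod $n+k$; $a_i$ is incomparable to $b_j$ iff $j\in\{i,\dots,i+k\}$ (mod $n+k$), otherwise $a_i<b_j$. $\mathrm{Inc}(A,B)$: incomparable pairs $(a,b)\in A\times B$; $G_n^k$: graph on $\mathrm{Inc}(A,B)$ with $(a,b)\sim(x,y)$ iff $a<y$ and $x<b$. A set $S\subseteq\mathrm{Inc}(A,B)$ is reversible if some linear extension $L$ of $S_n^k$ has $x>y$ in $L$ for all $(x,y)\in S$. An indexed set $\{(x_\alpha,y_\alpha):\alpha\in[m]\}$ of incomparable pairs is an alternating cycle of size $m$ if $x_\alpha\le y_{\alpha-1}$ for all $\alpha$ (indices cyclic mod $m$); it is strict if $x_\alpha\le y_\beta$ iff $\beta=\alpha-1$. -}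

module Defs where

open import Data.Nat using (ℕ; zero; suc; _+_; _≤_)
open import Data.Fin using (Fin; toℕ)
open import Data.Bool using (Bool; T)
open import Data.Product using (Σ; ∃; ∃-syntax; _×_; _,_)
open import Data.Sum using (_⊎_)
open import Data.Empty using (⊥)
open import Relation.Nullary using (¬_)
open import Relation.Binary.PropositionalEquality using (_≡_)

-- Ground set of the crown S_n^k with N = n + k : A = {a_0..a_{N-1}}, B = {b_0..b_{N-1}}
-- (0-based indices, cyclic mod N).
data Elem (N : ℕ) : Set where
  a : Fin N → Elem N
  b : Fin N → Elem N

-- j ∈ {i, i+1, ..., i+k} (mod N), i.e. j ≡ i + d (mod N) for some d ≤ k.
-- Since i, j < N this is: j = i + d or j + N = i + d.
CycInterval : (N k : ℕ) → Fin N → Fin N → Set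
CycInterval N k i j =
  ∃[ d ] (d ≤ k × (toℕ j ≡ toℕ i + d ⊎ toℕ j + N ≡ toℕ i + d))

-- Strict order of the crown S_n^k : a_i < b_j iff j ∉ {i,...,i+k} (mod n+k).
-- (N = n + k is the size of A; only k enters the definition.)
data CrownLt (N k : ℕ) : Elem N → Elem N → Set where
  a<b : ∀ {i j} → ¬ CycInterval N k i j → CrownLt N k (a i) (b j)

_<[_,_]_ : {N : ℕ} → Elem N → ℕ → ℕ → Elem N → Set
_<[_,_]_ {N} x n k y = CrownLt N k x y

_≤[_,_]_ : {N : ℕ} → Elem N → ℕ → ℕ → Elem N → Set
x ≤[ n , k ] y = x ≡ y ⊎ x <[ n , k ] y

Inc : (n k : ℕ) → Fin (n + k) → Fin (n + k) → Set
Inc n k i j = CycInterval (n + k) k i j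

PairSet : ℕ → Set
PairSet N = Fin N → Fin N → Bool

SubsetInc : (n k : ℕ) → PairSet (n + k) → Set
SubsetInc n k S = ∀ i j → T (S i j) → Inc n k i j

_⊆_ : {N : ℕ} → PairSet N → PairSet N → Set
S ⊆ S' = ∀ i j → T (S i j) → T (S' i j)

Adj : (n k : ℕ) → (i j x y : Fin (n + k)) → Set
Adj n k i j x y = (a i <[ n , k ] b y) × (a x <[ n , k ] b j)

Independent : (n k : ℕ) → PairSet (n + k) → Set
Independent n k S =
  SubsetInc n k S ×
  (∀ i j x y → T (S i j) → T (S x y) → ¬ Adj n k i j x y)

MaximalIndependent : (n k : ℕ) → PairSet (n + k) → Set
MaximalIndependent n k S =
  Independent n k S ×
  (∀ (S' : PairSet (n + k)) → Independent n k S' → S ⊆ S' → S' ⊆ S)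

record LinearExtension (n k : ℕ) : Set₁ where
  field
    _<L_    : Elem (n + k) → Elem (n + k) → Set
    irrefl  : ∀ x → ¬ (x <L x)
    trans   : ∀ {x y z} → x <L y → y <L z → x <L z
    total   : ∀ x y → x ≡ y ⊎ (x <L y ⊎ y <L x)
    extends : ∀ {x y} → x <[ n , k ] y → x <L y

Reversible : (n k : ℕ) → PairSet (n + k) → Set₁
Reversible n k S =
  Σ (LinearExtension n k) λ L →
    ∀ i j → T (S i j) → LinearExtension._<L_ L (b j) (a i)

IsPrev : (s : ℕ) → Fin s → Fin s → Set
IsPrev s α β = suc (toℕ β) ≡ toℕ α ⊎ (toℕ α ≡ 0 × suc (toℕ β) ≡ s)

-- A strict alternating cycle of size s, indexed by Fin s, consisting of
-- incomparable pairs (x_α, y_α) = (a_{i α}, b_{j α}), contained in S: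
--   x_α ≤ y_β  iff  β = α - 1 (mod s).
-- (Strictness includes the alternating-cycle condition x_α ≤ y_{α-1}.)
record StrictAltCycleIn (n k : ℕ) (S : PairSet (n + k)) (s : ℕ) : Set where
  field
    i j      : Fin s → Fin (n + k)
    incomp   : ∀ α → Inc n k (i α) (j α)
    inS      : ∀ α → T (S (i α) (j α))
    strict   : ∀ α β → (a (i α) ≤[ n , k ] b (j β)) → IsPrev s α β
    alt      : ∀ α β → IsPrev s α β → a (i α) ≤[ n , k ] b (j β)

-- If S contains an alternating 3-cycle, independence makes it strict: a comparability
-- x_α ≤ y_β with β ≠ α - 1 either contradicts the incomparability of (x_α , y_α) or
-- makes (x_α , y_α) and (x_β , y_β) adjacent in G_n^k.
-- Otherwise maximality makes S closed: if (x , y) , (x' , y') ∈ S and a_x' < b_y, then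
-- (x , y') ∈ S, because adding (x , y') to S could only destroy independence by creating
-- an alternating 3-cycle. For closed S put out(a_x) = {y' | (x , y') ∈ S} and let
-- out(b_y) be the union of the out(a_x') over a_x' < b_y. Then a_x < b_y gives
-- out(a_x) ⊆ out(b_y), while (x , y) ∈ S gives out(b_y) ⊊ out(a_x), the missing element
-- being y itself. Ordering the crown by |out(-)|, with ties broken by putting A before B,
-- is therefore a linear extension reversing S.
module Submission where

open import Defs
open import Data.Nat using (ℕ; _≤_; _+_)
open import Relation.Nullary using (¬_)

open import Data.Bool using (T; _∨_)
open import Data.Bool.Properties using (T?; T-≡; T-∨)
open import Data.Empty using (⊥-elim)
open import Data.Fin using (Fin; toℕ; zero; suc; _≟_) renaming (_<_ to _<ᶠ_)
import Data.Fin.Properties as Fin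
open import Data.Fin.Subset using (Subset; _∈_; ∣_∣) renaming (_⊆_ to _⊆ₛ_; _⊂_ to _⊂ₛ_)
open import Data.Fin.Subset.Properties using (p⊆q⇒∣p∣≤∣q∣; p⊂q⇒∣p∣<∣q∣)
import Data.Nat as ℕ
import Data.Nat.Properties as ℕ
open import Data.Product using (_×_; _,_; proj₁; ∃₂; swap)
open import Data.Product.Relation.Binary.Lex.Strict using (×-Lex; ×-isStrictTotalOrder)
open import Data.Sum using (_⊎_; inj₁; inj₂; map₂)
open import Data.Sum.Relation.Binary.LeftOrder using (_⊎-<_; ₁∼₂; ⊎-<-isStrictTotalOrder)
import Data.Sum.Relation.Binary.Pointwise as ⊎
open import Data.Product.Relation.Binary.Pointwise.NonDependent using (Pointwise)
open import Data.Vec using (tabulate)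
open import Data.Vec.Properties using (lookup∘tabulate; lookup⇒[]=; []=⇒lookup)
open import Function using (_∘_; Equivalence)
open import Level using (0ℓ)
open import Relation.Binary using (Rel; IsStrictTotalOrder; tri<; tri≈; tri>)
open import Relation.Binary.PropositionalEquality as ≡ using (_≡_; refl)
open import Relation.Nullary using (Dec; yes; no; ¬?)
open import Relation.Nullary.Decidable
  using (⌊_⌋; map′; _×-dec_; _⊎-dec_; toWitness; fromWitness; decidable-stable)
open import Relation.Unary as U using (Pred)

select : ∀ {m p} {P : Pred (Fin m) p} → U.Decidable P → Subset m
select P? = tabulate (λ x → ⌊ P? x ⌋)

module _ {m p} {P : Pred (Fin m) p} (P? : U.Decidable P) {x : Fin m} where

  ∈-select⁺ : P x → x ∈ select P?
  ∈-select⁺ px = lookup⇒[]= x _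
    (≡.trans (lookup∘tabulate _ x) (Equivalence.to T-≡ (fromWitness px)))

  ∈-select⁻ : x ∈ select P? → P x
  ∈-select⁻ x∈ = toWitness (Equivalence.from T-≡
    (≡.trans (≡.sym (lookup∘tabulate _ x)) ([]=⇒lookup x∈)))

insert : ∀ {N} → PairSet N → Fin N → Fin N → PairSet N
insert S x y i j = S i j ∨ ⌊ (i ≟ x) ×-dec (j ≟ y) ⌋

module _ {N} (S : PairSet N) {x y : Fin N} where

  ⊆-insert : S ⊆ insert S x y
  ⊆-insert _ _ = Equivalence.from T-∨ ∘ inj₁

  insert-∋ : T (insert S x y x y)
  insert-∋ = Equivalence.from (T-∨ {S x y}) (inj₂ (fromWitness (refl , refl)))

  ∈-insert⁻ : ∀ {i j} → T (insert S x y i j) → T (S i j) ⊎ (i ≡ x × j ≡ y)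
  ∈-insert⁻ = map₂ toWitness ∘ Equivalence.to T-∨

prev : Fin 3 → Fin 3
prev zero = suc (suc zero)
prev (suc zero) = zero
prev (suc (suc zero)) = suc zero

IsPrev-prev : ∀ α → IsPrev 3 α (prev α)
IsPrev-prev zero = inj₂ (refl , refl)
IsPrev-prev (suc zero) = inj₁ refl
IsPrev-prev (suc (suc zero)) = inj₁ refl

IsPrev⇒≡prev : ∀ {α β} → IsPrev 3 α β → β ≡ prev α
IsPrev⇒≡prev {zero} (inj₁ ())
IsPrev⇒≡prev {zero} (inj₂ (_ , 1+β≡3)) = Fin.toℕ-injective (ℕ.suc-injective 1+β≡3)
IsPrev⇒≡prev {suc zero} (inj₁ 1+β≡1) = Fin.toℕ-injective (ℕ.suc-injective 1+β≡1)
IsPrev⇒≡prev {suc zero} (inj₂ (() , _))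
IsPrev⇒≡prev {suc (suc zero)} (inj₁ 1+β≡2) = Fin.toℕ-injective (ℕ.suc-injective 1+β≡2)
IsPrev⇒≡prev {suc (suc zero)} (inj₂ (() , _))

prev-trichotomy : ∀ α β → β ≡ α ⊎ β ≡ prev α ⊎ α ≡ prev β
prev-trichotomy zero zero = inj₁ refl
prev-trichotomy zero (suc zero) = inj₂ (inj₂ refl)
prev-trichotomy zero (suc (suc zero)) = inj₂ (inj₁ refl)
prev-trichotomy (suc zero) zero = inj₂ (inj₁ refl)
prev-trichotomy (suc zero) (suc zero) = inj₁ refl
prev-trichotomy (suc zero) (suc (suc zero)) = inj₂ (inj₂ refl)
prev-trichotomy (suc (suc zero)) zero = inj₂ (inj₂ refl)
prev-trichotomy (suc (suc zero)) (suc zero) = inj₂ (inj₁ refl)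
prev-trichotomy (suc (suc zero)) (suc (suc zero)) = inj₁ refl

cycInterval? : ∀ N k (i j : Fin N) → Dec (CycInterval N k i j)
cycInterval? N k i j = map′
  (λ (d , d<1+k , p) → d , ℕ.≤-pred d<1+k , p)
  (λ (d , d≤k , p) → d , ℕ.s≤s d≤k , p)
  (ℕ.anyUpTo? (λ d → (toℕ j ℕ.≟ toℕ i + d) ⊎-dec (toℕ j + N ℕ.≟ toℕ i + d)) (ℕ.suc k))

module Crown (n k : ℕ) where

  N : ℕ
  N = n + k

  _≺_ : Fin N → Fin N → Set
  x ≺ y = a x <[ n , k ] b y

  _≺?_ : ∀ x y → Dec (x ≺ y)
  x ≺? y = map′ a<b (λ { (a<b ¬c) → ¬c }) (¬? (cycInterval? N k x y))

  Inc⇒⊀ : ∀ {x y} → Inc n k x y → ¬ x ≺ y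
  Inc⇒⊀ c (a<b ¬c) = ¬c c

  ⊀⇒Inc : ∀ {x y} → ¬ x ≺ y → Inc n k x y
  ⊀⇒Inc {x} {y} x⊀y = decidable-stable (cycInterval? N k x y) (x⊀y ∘ a<b)

  AlternatingTriangle : PairSet N → Set
  AlternatingTriangle S = ∃₂ λ x₀ y₀ → ∃₂ λ x₁ y₁ → ∃₂ λ x₂ y₂ →
    T (S x₀ y₀) × T (S x₁ y₁) × T (S x₂ y₂) × x₁ ≺ y₀ × x₂ ≺ y₁ × x₀ ≺ y₂

  alternatingTriangle? : ∀ S → Dec (AlternatingTriangle S)
  alternatingTriangle? S =
    Fin.any? λ x₀ → Fin.any? λ y₀ → Fin.any? λ x₁ → Fin.any? λ y₁ →
    Fin.any? λ x₂ → Fin.any? λ y₂ →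
    T? (S x₀ y₀) ×-dec T? (S x₁ y₁) ×-dec T? (S x₂ y₂) ×-dec
    x₁ ≺? y₀ ×-dec x₂ ≺? y₁ ×-dec x₀ ≺? y₂

  triangle⇒strictAltCycle : ∀ {S} → Independent n k S → AlternatingTriangle S →
    StrictAltCycleIn n k S 3
  triangle⇒strictAltCycle {S} (S⊆Inc , independent)
    (x₀ , y₀ , x₁ , y₁ , x₂ , y₂ , p₀ , p₁ , p₂ , x₁≺y₀ , x₂≺y₁ , x₀≺y₂) =
    record { i = x ; j = y ; incomp = λ α → S⊆Inc _ _ (inS α) ; inS = inS
           ; strict = strict ; alt = alt }
    where
    x y : Fin 3 → Fin N
    x zero = x₀
    x (suc zero) = x₁
    x (suc (suc zero)) = x₂
    y zero = y₀
    y (suc zero) = y₁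
    y (suc (suc zero)) = y₂

    inS : ∀ α → T (S (x α) (y α))
    inS zero = p₀
    inS (suc zero) = p₁
    inS (suc (suc zero)) = p₂

    edge : ∀ α → x α ≺ y (prev α)
    edge zero = x₀≺y₂
    edge (suc zero) = x₁≺y₀
    edge (suc (suc zero)) = x₂≺y₁

    strict : ∀ α β → a (x α) ≤[ n , k ] b (y β) → IsPrev 3 α β
    strict α β (inj₂ xα≺yβ) with prev-trichotomy α β
    ... | inj₁ refl = ⊥-elim (Inc⇒⊀ (S⊆Inc _ _ (inS α)) xα≺yβ)
    ... | inj₂ (inj₁ refl) = IsPrev-prev α
    ... | inj₂ (inj₂ refl) = ⊥-elim (independent _ _ _ _ (inS α) (inS β) (xα≺yβ , edge β))

    alt : ∀ α β → IsPrev 3 α β → a (x α) ≤[ n , k ] b (y β)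
    alt α β β-prev rewrite IsPrev⇒≡prev β-prev = inj₂ (edge α)

  insert-independent : ∀ {S x y} → Independent n k S → ¬ x ≺ y →
    (∀ u v → T (S u v) → ¬ Adj n k x y u v) → Independent n k (insert S x y)
  insert-independent {S} {x} {y} (S⊆Inc , independent) x⊀y nonadjacent = ⊆Inc , independent′
    where
    ⊆Inc : SubsetInc n k (insert S x y)
    ⊆Inc i j ij∈ with ∈-insert⁻ S ij∈
    ... | inj₁ ij∈S = S⊆Inc i j ij∈S
    ... | inj₂ (refl , refl) = ⊀⇒Inc x⊀y

    independent′ : ∀ i j u v → T (insert S x y i j) → T (insert S x y u v) →
      ¬ Adj n k i j u v
    independent′ i j u v ij∈ uv∈ with ∈-insert⁻ S ij∈ | ∈-insert⁻ S uv∈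
    ... | inj₁ ij∈S | inj₁ uv∈S = independent i j u v ij∈S uv∈S
    ... | inj₂ (refl , refl) | inj₁ uv∈S = nonadjacent u v uv∈S
    ... | inj₁ ij∈S | inj₂ (refl , refl) = nonadjacent i j ij∈S ∘ swap
    ... | inj₂ (refl , refl) | inj₂ (refl , refl) = x⊀y ∘ proj₁

  Closed : PairSet N → Set
  Closed S = ∀ {x y x′ y′} → T (S x y) → T (S x′ y′) → x′ ≺ y → T (S x y′)

  maximal⇒closed : ∀ {S} → MaximalIndependent n k S → ¬ AlternatingTriangle S → Closed S
  maximal⇒closed {S} (indep@(_ , independent) , maximal) ¬triangle {x} {y} {x′} {y′}
    xy∈S x′y′∈S x′≺y = maximal (insert S x y′) independent′ (⊆-insert S) x y′ (insert-∋ S)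
    where
    independent′ : Independent n k (insert S x y′)
    independent′ = insert-independent indep
      (λ x≺y′ → independent x y x′ y′ xy∈S x′y′∈S (x≺y′ , x′≺y))
      (λ u v uv∈S (x≺v , u≺y′) →
        ¬triangle (x , y , x′ , y′ , u , v , xy∈S , x′y′∈S , uv∈S , x′≺y , u≺y′ , x≺v))

  linearExtension : ∀ {ℓ} {K : Set} {_≈_ : Rel K ℓ} {_<_ : Rel K 0ℓ} →
    IsStrictTotalOrder _≈_ _<_ → (key : Elem N → K) →
    (∀ {e f} → key e ≈ key f → e ≡ f) →
    (∀ {e f} → e <[ n , k ] f → key e < key f) → LinearExtension n k
  linearExtension {_<_ = _<_} sto key key-injective key-monotone = record
    { _<L_ = λ e f → key e < key f
    ; irrefl = λ _ → irrefl Eq.refl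
    ; trans = trans
    ; total = total
    ; extends = key-monotone
    }
    where
    open IsStrictTotalOrder sto
    total : ∀ e f → e ≡ f ⊎ (key e < key f ⊎ key f < key e)
    total e f with compare (key e) (key f)
    ... | tri< e<f _ _ = inj₂ (inj₁ e<f)
    ... | tri≈ _ e≈f _ = inj₁ (key-injective e≈f)
    ... | tri> _ _ f<e = inj₂ (inj₂ f<e)

  closed⇒reversible : ∀ {S} → SubsetInc n k S → Closed S → Reversible n k S
  closed⇒reversible {S} S⊆Inc closed =
    linearExtension sto key key-injective key-monotone ,
    λ x y xy∈S → inj₁ (p⊂q⇒∣p∣<∣q∣ (outBelow⊂out xy∈S))
    where
    out : Fin N → Subset N
    out x = select (λ y → T? (S x y))

    outBelow : Fin N → Subset N
    outBelow y = select (λ y′ → Fin.any? (λ x → x ≺? y ×-dec T? (S x y′)))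

    out⊆outBelow : ∀ {x y} → x ≺ y → out x ⊆ₛ outBelow y
    out⊆outBelow x≺y y′∈ = ∈-select⁺ _ (_ , x≺y , ∈-select⁻ _ y′∈)

    outBelow⊂out : ∀ {x y} → T (S x y) → outBelow y ⊂ₛ out x
    outBelow⊂out xy∈S =
      (λ y′∈ → let (_ , x′≺y , x′y′∈S) = ∈-select⁻ _ y′∈ in
               ∈-select⁺ _ (closed xy∈S x′y′∈S x′≺y)) ,
      _ , ∈-select⁺ _ xy∈S ,
      (λ y∈ → let (_ , x′≺y , x′y∈S) = ∈-select⁻ _ y∈ in
              Inc⇒⊀ (S⊆Inc _ _ x′y∈S) x′≺y)

    key : Elem N → ℕ × (Fin N ⊎ Fin N)
    key (a x) = ∣ out x ∣ , inj₁ x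
    key (b y) = ∣ outBelow y ∣ , inj₂ y

    _≈ₖ_ _<ₖ_ : Rel (ℕ × (Fin N ⊎ Fin N)) 0ℓ
    _≈ₖ_ = Pointwise _≡_ (⊎.Pointwise _≡_ _≡_)
    _<ₖ_ = ×-Lex _≡_ ℕ._<_ (_<ᶠ_ ⊎-< _<ᶠ_)

    sto : IsStrictTotalOrder _≈ₖ_ _<ₖ_
    sto = ×-isStrictTotalOrder ℕ.<-isStrictTotalOrder
            (⊎-<-isStrictTotalOrder Fin.<-isStrictTotalOrder Fin.<-isStrictTotalOrder)

    key-injective : ∀ {e f} → key e ≈ₖ key f → e ≡ f
    key-injective {a _} {a _} (_ , ⊎.inj₁ refl) = refl
    key-injective {b _} {b _} (_ , ⊎.inj₂ refl) = refl

    key-monotone : ∀ {e f} → e <[ n , k ] f → key e <ₖ key f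
    key-monotone (a<b ¬c) with ℕ.m≤n⇒m<n∨m≡n (p⊆q⇒∣p∣≤∣q∣ (out⊆outBelow (a<b ¬c)))
    ... | inj₁ |out|<|outBelow| = inj₁ |out|<|outBelow|
    ... | inj₂ |out|≡|outBelow| = inj₂ (|out|≡|outBelow| , ₁∼₂)

lemma4p5 : (n k : ℕ) → 3 ≤ n → (S : PairSet (n + k)) →
    MaximalIndependent n k S → ¬ Reversible n k S →
    StrictAltCycleIn n k S 3
lemma4p5 n k _ S maximal@(indep@(S⊆Inc , _) , _) ¬reversible = cycle (alternatingTriangle? S)
  where
  open Crown n k
  cycle : Dec (AlternatingTriangle S) → StrictAltCycleIn n k S 3
  cycle (yes triangle) = triangle⇒strictAltCycle indep triangle
  cycle (no ¬triangle) =
    ⊥-elim (¬reversible (closed⇒reversible S⊆Inc (maximal⇒closed maximal ¬triangle)))
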